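{- Let $n\ge 2$ and $t$ be integers with $1\le t\le n-1$, and let $\mathbf a=a_1\cdots a_n$, $\mathbf b=b_1\cdots b_n$ be vertices of $G(n)$. If $\mathrm{st}(a_{t+1}\cdots a_n)=\mathrm{st}(b_1\cdots b_{n-t})$, then there is a walk of length $t$ in $G(n)$ from $\mathbf a$ to $\mathbf b$.
   Context: For a sequence of distinct integers $c_1\cdots c_s$, $\mathrm{st}(c_1\cdots c_s)$ is the unique permutation $d_1\cdots d_s$ of $\{1,\dots,s\}$ with $d_i<d_j$ iff $c_i<c_j$. $G(n)$ is the directed multigraph whose vertices are the permutations of $\{1,\dots,n\}$ (one-line notation) and whose edges are the permutations $c_1\cdots c_{n+1}$ of $\{1,\dots,n+1\}$, the edge $c_1\cdots c_{n+1}$ going from $\mathrm{st}(c_1\cdots c_n)$ to $\mathrm{st}(c_2\cdots c_{n+1})$; so there is an edge from $x_1\cdots x_n$ to $w_1\cdots w_n$ iff $\mathrm{st}(x_2\cdots x_n)=\mathrm{st}(w_1\cdots w_{n-1})$. A walk of length $t$ from $v_1$ to $v_{t+1}$ is a sequence $(v_1,e_1,v_2,\dots,e_t,v_{t+1})$ with $e_i$ an edge from $v_i$ to $v_{i+1}$. -}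

module Defs where

open import Data.Nat using (ℕ; zero; suc; _<?_)
open import Data.List using (List; map; upTo; take; drop; filter; length)
open import Data.List.Relation.Binary.Permutation.Propositional using (_↭_)
open import Relation.Binary.PropositionalEquality using (_≡_)

oneTo : ℕ → List ℕ
oneTo n = map suc (upTo n)

-- xs is a permutation of {1,...,n} in one-line notation
IsPerm : ℕ → List ℕ → Set
IsPerm n xs = xs ↭ oneTo n

-- standardization: the i-th entry becomes 1 + #{j : c_j < c_i}.
-- For a sequence of distinct integers this is exactly st(c_1 ... c_s).
st : List ℕ → List ℕ
st cs = map (λ c → suc (length (filter (_<? c) cs))) cs

Vertex : ℕ → List ℕ → Set
Vertex n xs = IsPerm n xs

record Edge (n : ℕ) (u w : List ℕ) : Set where
  constructor edge
  field
    label  : List ℕ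
    isPerm : IsPerm (suc n) label
    src    : st (take n label) ≡ u
    tgt    : st (drop 1 label) ≡ w

data Walk (n : ℕ) : List ℕ → List ℕ → ℕ → Set where
  here : ∀ {v} → Vertex n v → Walk n v v zero
  step : ∀ {u w v t} → Vertex n u → Edge n u w → Walk n w v t → Walk n u v (suc t)

module Submission where

-- If c is a sequence of n + t distinct numbers, its standardized windows of length n and n + 1
-- form a walk of length t in G(n) from st(c₁ … cₙ) to st(c_{t+1} … c_{n+t}).  So it suffices to
-- glue a and b into such a c.  Take a with each entry x replaced by (K + 1)(x + 1), where K exceeds
-- every entry of b, and append the last t entries v of b, each placed just above the largest
-- overlap entry of a whose partner in b lies below v, at offset v + 1 < K + 1.  Because
-- st(a_{t+1} … aₙ) = st(b₁ … b_{n-t}), the overlap entries of a are ordered exactly like their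
-- partners in b, and so the last n entries of c are order-isomorphic to b.

open import Defs
open import Data.Nat using (ℕ; zero; suc; pred; _≤_; _<_; _∸_; _+_; _*_; _⊓_; z≤n; s≤s; z<s; s<s)
open import Data.Nat.Properties
open import Data.List using (List; []; _∷_; _++_; map; filter; length; take; drop; upTo; zip)
open import Data.List.Properties
  using ( filter-accept; filter-reject; filter-none; map-upTo; map-cong; map-cong-local; map-id-local
        ; map-id; map-∘; map-++; length-map; length-upTo; length-take; length-drop; length-++
        ; take-map; drop-map; take++drop≡id; take-all; take-take)
open import Data.List.Extrema.Nat using (min; min≤⊤; min≤xs; argmin-sel; max; xs≤max; max≤v⁺; max-mono-⊆)
open import Data.List.Relation.Unary.All as All using (All; []; _∷_)
import Data.List.Relation.Unary.All.Properties as AllP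
import Data.List.Relation.Unary.AllPairs as AllPairs
open AllPairs using (_∷_)
open import Data.List.Relation.Unary.Unique.Propositional using (Unique)
import Data.List.Relation.Unary.Unique.Propositional.Properties as UP
open import Data.List.Relation.Binary.Permutation.Propositional
  using (_↭_; ↭-refl; ↭-sym; ↭-prep; ↭⇒↭ₛ; module PermutationReasoning)
open import Data.List.Relation.Binary.Permutation.Propositional.Properties
  using (↭-length; filter-↭; shift; All-resp-↭) renaming (map⁺ to ↭-map⁺)
open import Data.List.Membership.Propositional using (_∈_)
open import Data.List.Membership.Propositional.Properties
  using (∈-∃++; ∈-++⁻; ∈-++⁺ˡ; ∈-++⁺ʳ; ∈-map⁺; ∈-map⁻; ∈-filter⁺; ∈-filter⁻)
open import Data.List.Relation.Binary.Subset.Propositional using (_⊆_)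
open import Data.List.Relation.Binary.Subset.Propositional.Properties
  using (⊆-refl) renaming (map⁺ to ⊆-map⁺; filter⁺′ to ⊆-filter⁺′)
open import Data.List.Relation.Binary.Disjoint.Propositional using (Disjoint)
import Data.List.Relation.Binary.Pointwise as Pointwise
open import Data.List.Relation.Unary.Any using (here; there)
open import Data.Product as Product using (_×_; _,_; proj₁; proj₂; ∃; ∃₂)
open import Data.Sum using (inj₁; inj₂; [_,_]′)
open import Function using (_∘_; id)
open import Relation.Binary.Core using (_Preserves_⟶_)
open import Relation.Binary.Definitions using (tri<; tri≈; tri>)
open import Relation.Nullary using (¬_; yes; no)
open import Relation.Nullary.Negation using (contradiction)
open import Relation.Binary.PropositionalEquality
open import Data.List.Relation.Binary.Permutation.Setoid.Properties (setoid ℕ) using (Unique-resp-↭)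

module _ {A : Set} where

  take-⊆ : ∀ k (xs : List A) → take k xs ⊆ xs
  take-⊆ k xs p∈ = subst (_ ∈_) (take++drop≡id k xs) (∈-++⁺ˡ p∈)

  drop-⊆ : ∀ k (xs : List A) → drop k xs ⊆ xs
  drop-⊆ k xs p∈ = subst (_ ∈_) (take++drop≡id k xs) (∈-++⁺ʳ (take k xs) p∈)

  take-length-++ : ∀ (xs ys : List A) → take (length xs) (xs ++ ys) ≡ xs
  take-length-++ []       ys = refl
  take-length-++ (x ∷ xs) ys = cong (x ∷_) (take-length-++ xs ys)

  drop-++-≤ : ∀ k (xs ys : List A) → k ≤ length xs → drop k (xs ++ ys) ≡ drop k xs ++ ys
  drop-++-≤ zero    xs       ys _         = refl
  drop-++-≤ (suc k) (x ∷ xs) ys (s≤s k≤) = drop-++-≤ k xs ys k≤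

  length-take-∸ : ∀ (xs ys : List A) {n t} → length xs ≡ n → length ys ≡ n → t ≤ n →
    length (take (n ∸ t) xs) ≡ length (drop t ys)
  length-take-∸ xs ys {n} {t} |xs| |ys| t≤n = begin
    length (take (n ∸ t) xs)  ≡⟨ length-take (n ∸ t) xs ⟩
    (n ∸ t) ⊓ length xs       ≡⟨ cong ((n ∸ t) ⊓_) |xs| ⟩
    (n ∸ t) ⊓ n               ≡⟨ m≤n⇒m⊓n≡m (m∸n≤m n t) ⟩
    n ∸ t                     ≡⟨ cong (_∸ t) |ys| ⟨
    length ys ∸ t             ≡⟨ length-drop t ys ⟨
    length (drop t ys)        ∎
    where open ≡-Reasoning

module _ {A B : Set} where

  zip-∈ : ∀ {x y} {xs : List A} {ys : List B} → (x , y) ∈ zip xs ys → x ∈ xs × y ∈ ys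
  zip-∈ {xs = _ ∷ _} {_ ∷ _} (here refl) = here refl , here refl
  zip-∈ {xs = _ ∷ _} {_ ∷ _} (there p∈)  = Product.map there there (zip-∈ p∈)

  map-proj₁-zip : ∀ {xs : List A} {ys : List B} → length xs ≡ length ys → map proj₁ (zip xs ys) ≡ xs
  map-proj₁-zip {[]}     {[]}     _   = refl
  map-proj₁-zip {x ∷ xs} {y ∷ ys} len = cong (x ∷_) (map-proj₁-zip (suc-injective len))

  map-proj₂-zip : ∀ {xs : List A} {ys : List B} → length xs ≡ length ys → map proj₂ (zip xs ys) ≡ ys
  map-proj₂-zip {[]}     {[]}     _   = refl
  map-proj₂-zip {x ∷ xs} {y ∷ ys} len = cong (y ∷_) (map-proj₂-zip (suc-injective len))

unique-++⇒disjoint : ∀ xs {ys : List ℕ} → Unique (xs ++ ys) → Disjoint xs ys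
unique-++⇒disjoint (x ∷ xs) (x≢ ∷ _) (here refl , x∈ys) = All.lookup (AllP.++⁻ʳ xs x≢) x∈ys refl
unique-++⇒disjoint (x ∷ xs) (_ ∷ u)  (there v∈xs , v∈ys) = unique-++⇒disjoint xs u (v∈xs , v∈ys)

min-∈ : ∀ x xs → min x xs ∈ x ∷ xs
min-∈ x xs = [ here , there ]′ (argmin-sel id x xs)

module _ {f : ℕ → ℕ} (f-mono : f Preserves _<_ ⟶ _<_) where

  strictMono-cancel-< : ∀ {x y} → f x < f y → x < y
  strictMono-cancel-< {x} {y} fx<fy with <-cmp x y
  ... | tri< x<y _ _ = x<y
  ... | tri≈ _ refl _ = contradiction fx<fy (<-irrefl refl)
  ... | tri> _ _ y<x = contradiction (f-mono y<x) (<-asym fx<fy)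

  strictMono-injective : ∀ {x y} → f x ≡ f y → x ≡ y
  strictMono-injective {x} {y} fx≡fy with <-cmp x y
  ... | tri< x<y _ _ = contradiction fx≡fy (<⇒≢ (f-mono x<y))
  ... | tri≈ _ x≡y _ = x≡y
  ... | tri> _ _ y<x = contradiction fx≡fy (>⇒≢ (f-mono y<x))

m*a<m*b+r : ∀ m {a b r} → 0 < r → a ≤ b → m * a < m * b + r
m*a<m*b+r m {b = b} 0<r a≤b = ≤-<-trans (*-monoʳ-≤ m a≤b) (m<m+n (m * b) 0<r)

m*b+r<m*a : ∀ m {a b r} → r < m → b < a → m * b + r < m * a
m*b+r<m*a m {a} {b} {r} r<m b<a = begin-strict
  m * b + r  <⟨ +-monoʳ-< (m * b) r<m ⟩
  m * b + m  ≡⟨ trans (+-comm (m * b) m) (sym (*-suc m b)) ⟩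
  m * suc b  ≤⟨ *-monoʳ-≤ m b<a ⟩
  m * a      ∎
  where open ≤-Reasoning

rank : ℕ → List ℕ → ℕ
rank c xs = length (filter (_<? c) xs)

rank-∷-< : ∀ {x c} xs → x < c → rank c (x ∷ xs) ≡ suc (rank c xs)
rank-∷-< {c = c} xs x<c = cong length (filter-accept (_<? c) x<c)

rank-∷-≮ : ∀ {x c} xs → ¬ x < c → rank c (x ∷ xs) ≡ rank c xs
rank-∷-≮ {c = c} xs x≮c = cong length (filter-reject (_<? c) x≮c)

rank-↭ : ∀ c {xs ys} → xs ↭ ys → rank c xs ≡ rank c ys
rank-↭ c xs↭ys = ↭-length (filter-↭ (_<? c) xs↭ys)

rank-none : ∀ {c xs} → All (c ≤_) xs → rank c xs ≡ 0
rank-none {c} c≤xs = cong length (filter-none (_<? c) (All.map ≤⇒≯ c≤xs))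

rank-mono-≤ : ∀ {c d} xs → c ≤ d → rank c xs ≤ rank d xs
rank-mono-≤ []       c≤d = z≤n
rank-mono-≤ {c} {d} (x ∷ xs) c≤d with x <? c | x <? d
... | yes x<c | yes x<d rewrite rank-∷-< xs x<c | rank-∷-< xs x<d = s≤s (rank-mono-≤ xs c≤d)
... | yes x<c | no  x≮d = contradiction (<-≤-trans x<c c≤d) x≮d
... | no  x≮c | yes x<d rewrite rank-∷-≮ xs x≮c | rank-∷-< xs x<d = m≤n⇒m≤1+n (rank-mono-≤ xs c≤d)
... | no  x≮c | no  x≮d rewrite rank-∷-≮ xs x≮c | rank-∷-≮ xs x≮d = rank-mono-≤ xs c≤d

rank-mono-< : ∀ {c d xs} → c ∈ xs → c < d → rank c xs < rank d xs
rank-mono-< {c} {d} {_ ∷ ys} (here refl) c<d = begin-strict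
  rank c (c ∷ ys)  ≡⟨ rank-∷-≮ ys (<-irrefl refl) ⟩
  rank c ys        <⟨ s≤s (rank-mono-≤ ys (<⇒≤ c<d)) ⟩
  suc (rank d ys)  ≡⟨ rank-∷-< ys c<d ⟨
  rank d (c ∷ ys)  ∎
  where open ≤-Reasoning
rank-mono-< {c} {d} {y ∷ ys} (there c∈ys) c<d with y <? c | y <? d
... | yes y<c | yes y<d rewrite rank-∷-< ys y<c | rank-∷-< ys y<d = s<s (rank-mono-< c∈ys c<d)
... | yes y<c | no  y≮d = contradiction (<-trans y<c c<d) y≮d
... | no  y≮c | yes y<d rewrite rank-∷-≮ ys y≮c | rank-∷-< ys y<d = m<n⇒m<1+n (rank-mono-< c∈ys c<d)
... | no  y≮c | no  y≮d rewrite rank-∷-≮ ys y≮c | rank-∷-≮ ys y≮d = rank-mono-< c∈ys c<d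

rank-cancel-< : ∀ {c d} xs → rank c xs < rank d xs → c < d
rank-cancel-< {c} {d} xs rc<rd with c <? d
... | yes c<d = c<d
... | no  c≮d = contradiction (rank-mono-≤ xs (≮⇒≥ c≮d)) (<⇒≱ rc<rd)

rank-map : ∀ {f : ℕ → ℕ} → f Preserves _<_ ⟶ _<_ → ∀ c xs → rank (f c) (map f xs) ≡ rank c xs
rank-map f-mono c [] = refl
rank-map {f} f-mono c (x ∷ xs) with x <? c
... | yes x<c rewrite rank-∷-< (map f xs) (f-mono x<c) | rank-∷-< xs x<c = cong suc (rank-map f-mono c xs)
... | no  x≮c rewrite rank-∷-≮ (map f xs) (x≮c ∘ strictMono-cancel-< f-mono) | rank-∷-≮ xs x≮c =
  rank-map f-mono c xs

oneTo-suc : ∀ n → oneTo (suc n) ≡ 1 ∷ map suc (oneTo n)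
oneTo-suc n = cong (λ xs → 1 ∷ map suc xs) (sym (map-upTo suc n))

rank-oneTo : ∀ {k n} → k < n → rank (suc k) (oneTo n) ≡ k
rank-oneTo {zero} {suc n} _ = begin
  rank 1 (oneTo (suc n))          ≡⟨ cong (rank 1) (oneTo-suc n) ⟩
  rank 1 (1 ∷ map suc (oneTo n))  ≡⟨ rank-∷-≮ (map suc (oneTo n)) (<-irrefl refl) ⟩
  rank 1 (map suc (oneTo n))      ≡⟨ rank-map s<s 0 (oneTo n) ⟩
  rank 0 (oneTo n)                ≡⟨ rank-none {xs = oneTo n} (All.tabulate (λ _ → z≤n)) ⟩
  0                               ∎
  where open ≡-Reasoning
rank-oneTo {suc k} {suc n} (s<s k<n) = begin
  rank (2 + k) (oneTo (suc n))          ≡⟨ cong (rank (2 + k)) (oneTo-suc n) ⟩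
  rank (2 + k) (1 ∷ map suc (oneTo n))  ≡⟨ rank-∷-< (map suc (oneTo n)) (s<s z<s) ⟩
  suc (rank (2 + k) (map suc (oneTo n))) ≡⟨ cong suc (rank-map s<s (suc k) (oneTo n)) ⟩
  suc (rank (suc k) (oneTo n))          ≡⟨ cong suc (rank-oneTo k<n) ⟩
  suc k                                 ∎
  where open ≡-Reasoning

-- Standardization

st-map : ∀ {f : ℕ → ℕ} → f Preserves _<_ ⟶ _<_ → ∀ xs → st (map f xs) ≡ st xs
st-map {f} f-mono xs = trans (sym (map-∘ xs)) (map-cong (λ c → cong suc (rank-map f-mono c xs)) xs)

st-↭ : ∀ {xs ys} → xs ↭ ys → st xs ↭ st ys
st-↭ {xs} {ys} xs↭ys = begin
  map (λ c → suc (rank c xs)) xs  ≡⟨ map-cong (λ c → cong suc (rank-↭ c xs↭ys)) xs ⟩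
  map (λ c → suc (rank c ys)) xs  ↭⟨ ↭-map⁺ (λ c → suc (rank c ys)) xs↭ys ⟩
  map (λ c → suc (rank c ys)) ys  ∎
  where open PermutationReasoning

st-∷-min : ∀ {μ xs} → All (μ <_) xs → st (μ ∷ xs) ≡ 1 ∷ map suc (st xs)
st-∷-min {μ} {xs} μ<xs = cong₂ _∷_
  (cong suc (trans (rank-∷-≮ xs (<-irrefl refl)) (rank-none (All.map <⇒≤ μ<xs))))
  (trans (map-cong-local (All.map (λ μ<c → cong suc (rank-∷-< xs μ<c)) μ<xs)) (map-∘ xs))

extractMin : ∀ x xs → Unique (x ∷ xs) →
  ∃₂ λ μ rest → x ∷ xs ↭ μ ∷ rest × All (μ <_) rest × Unique rest
extractMin x xs u with x₁ , x₂ , eq ← ∈-∃++ (min-∈ x xs) =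
  μ , x₁ ++ x₂ , x∷xs↭ , All.zipWith (λ (μ≤c , μ≢c) → ≤∧≢⇒< μ≤c μ≢c) (μ≤rest , μ≢rest) , urest
  where
  μ = min x xs
  x∷xs↭ : x ∷ xs ↭ μ ∷ x₁ ++ x₂
  x∷xs↭ = subst (_↭ μ ∷ x₁ ++ x₂) (sym eq) (shift μ x₁ x₂)
  μ∷urest : Unique (μ ∷ x₁ ++ x₂)
  μ∷urest = Unique-resp-↭ (↭⇒↭ₛ x∷xs↭) u
  μ≢rest = AllPairs.head μ∷urest
  urest = AllPairs.tail μ∷urest
  μ≤rest : All (μ ≤_) (x₁ ++ x₂)
  μ≤rest = All.tail (All-resp-↭ x∷xs↭ (min≤⊤ x xs ∷ min≤xs x xs))

st-isPerm : ∀ xs → Unique xs → IsPerm (length xs) (st xs)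
st-isPerm xs = go (length xs) xs refl
  where
  go : ∀ m xs → length xs ≡ m → Unique xs → st xs ↭ oneTo m
  go zero    []       _   _ = ↭-refl
  go (suc m) (x ∷ xs) len u with μ , rest , perm , μ<rest , urest ← extractMin x xs u = begin
    st (x ∷ xs)                ↭⟨ st-↭ perm ⟩
    st (μ ∷ rest)              ≡⟨ st-∷-min μ<rest ⟩
    1 ∷ map suc (st rest)      ↭⟨ ↭-prep 1 (↭-map⁺ suc (go m rest |rest| urest)) ⟩
    1 ∷ map suc (oneTo m)      ≡⟨ oneTo-suc m ⟨
    oneTo (suc m)              ∎
    where
    open PermutationReasoning
    |rest| : length rest ≡ m
    |rest| = suc-injective (trans (sym (↭-length perm)) len)

oneTo-bounds : ∀ n → All (λ c → 0 < c × c ≤ n) (oneTo n)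
oneTo-bounds n = AllP.map⁺ (All.map (λ k<n → z<s , k<n) (AllP.all-upTo n))

module _ {n a} (a↭ : IsPerm n a) where

  isPerm-bounds : All (λ c → 0 < c × c ≤ n) a
  isPerm-bounds = All-resp-↭ (↭-sym a↭) (oneTo-bounds n)

  isPerm-unique : Unique a
  isPerm-unique = Unique-resp-↭ (↭⇒↭ₛ (↭-sym a↭)) (UP.map⁺ suc-injective (UP.upTo⁺ n))

  isPerm-length : length a ≡ n
  isPerm-length = trans (↭-length a↭) (trans (length-map suc (upTo n)) (length-upTo n))

  st-fixesPerm : st a ≡ a
  st-fixesPerm = map-id-local (All.map fixed isPerm-bounds)
    where
    fixed : ∀ {c} → 0 < c × c ≤ n → suc (rank c a) ≡ c
    fixed {suc k} (_ , k<n) = cong suc (trans (rank-↭ (suc k) a↭) (rank-oneTo k<n))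

-- Order isomorphism

SameOrder : ℕ × ℕ → ℕ × ℕ → Set
SameOrder (x , y) (x′ , y′) = (x < x′ → y < y′) × (y < y′ → x < x′)

OrderIsomorphic : List (ℕ × ℕ) → Set
OrderIsomorphic Z = ∀ {p q} → p ∈ Z → q ∈ Z → SameOrder p q

orderIsomorphic-⊆ : ∀ {Z′ Z} → Z′ ⊆ Z → OrderIsomorphic Z → OrderIsomorphic Z′
orderIsomorphic-⊆ Z′⊆Z oi p∈Z′ q∈Z′ = oi (Z′⊆Z p∈Z′) (Z′⊆Z q∈Z′)

++-orderIsomorphic : ∀ {Z₁ Z₂} → OrderIsomorphic Z₁ → OrderIsomorphic Z₂ →
  (∀ {p q} → p ∈ Z₁ → q ∈ Z₂ → SameOrder p q × SameOrder q p) →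
  OrderIsomorphic (Z₁ ++ Z₂)
++-orderIsomorphic {Z₁} oi₁ oi₂ cross p∈ q∈ with ∈-++⁻ Z₁ p∈ | ∈-++⁻ Z₁ q∈
... | inj₁ p∈₁ | inj₁ q∈₁ = oi₁ p∈₁ q∈₁
... | inj₁ p∈₁ | inj₂ q∈₂ = proj₁ (cross p∈₁ q∈₂)
... | inj₂ p∈₂ | inj₁ q∈₁ = proj₂ (cross q∈₁ p∈₂)
... | inj₂ p∈₂ | inj₂ q∈₂ = oi₂ p∈₂ q∈₂

sameOrder-trichotomy : ∀ {x y x′ y′} → x ≢ x′ → (x < x′ → y < y′) → (x′ < x → y′ < y) →
  SameOrder (x , y) (x′ , y′) × SameOrder (x′ , y′) (x , y)
sameOrder-trichotomy {x} {y} {x′} {y′} x≢x′ up down = (up , reflect-up) , (down , reflect-down)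
  where
  reflect-up : y < y′ → x < x′
  reflect-up y<y′ with <-cmp x x′
  ... | tri< x<x′ _ _ = x<x′
  ... | tri≈ _ x≡x′ _ = contradiction x≡x′ x≢x′
  ... | tri> _ _ x′<x = contradiction (down x′<x) (<-asym y<y′)
  reflect-down : y′ < y → x′ < x
  reflect-down y′<y with <-cmp x x′
  ... | tri< x<x′ _ _ = contradiction (up x<x′) (<-asym y′<y)
  ... | tri≈ _ x≡x′ _ = contradiction x≡x′ x≢x′
  ... | tri> _ _ x′<x = x′<x

map₂-orderIsomorphic : ∀ {f : ℕ → ℕ} → f Preserves _<_ ⟶ _<_ →
  ∀ Z → OrderIsomorphic Z → OrderIsomorphic (map (Product.map₂ f) Z)
map₂-orderIsomorphic f-mono Z oi p∈ q∈
  with _ , p′∈ , refl ← ∈-map⁻ _ p∈ | _ , q′∈ , refl ← ∈-map⁻ _ q∈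
  = let (to , from) = oi p′∈ q′∈ in f-mono ∘ to , from ∘ strictMono-cancel-< f-mono

graph : (ℕ → ℕ) → List ℕ → List (ℕ × ℕ)
graph h xs = map (λ x → x , h x) xs

map-proj₁-graph : ∀ h xs → map proj₁ (graph h xs) ≡ xs
map-proj₁-graph h xs = trans (sym (map-∘ xs)) (map-id xs)

map-proj₂-graph : ∀ h xs → map proj₂ (graph h xs) ≡ map h xs
map-proj₂-graph h xs = sym (map-∘ xs)

graph-orderIsomorphic : ∀ {h} xs → (∀ {v w} → v ∈ xs → v < w → h v < h w) →
  OrderIsomorphic (graph h xs)
graph-orderIsomorphic {h} xs h-mono p∈ q∈
  with v , v∈ , refl ← ∈-map⁻ _ p∈ | w , w∈ , refl ← ∈-map⁻ _ q∈
  = h-mono v∈ , reflect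
  where
  reflect : h v < h w → v < w
  reflect hv<hw with <-cmp v w
  ... | tri< v<w _ _ = v<w
  ... | tri≈ _ refl _ = contradiction hv<hw (<-irrefl refl)
  ... | tri> _ _ w<v = contradiction (h-mono w∈ w<v) (<-asym hv<hw)

rank-sameOrder : ∀ {v w} Z → All (λ q → SameOrder q (v , w)) Z →
  rank v (map proj₁ Z) ≡ rank w (map proj₂ Z)
rank-sameOrder [] [] = refl
rank-sameOrder {v} {w} ((x , y) ∷ Z) ((to , from) ∷ Z∼) with x <? v | y <? w
... | yes x<v | yes y<w rewrite rank-∷-< (map proj₁ Z) x<v | rank-∷-< (map proj₂ Z) y<w =
  cong suc (rank-sameOrder Z Z∼)
... | yes x<v | no  y≮w = contradiction (to x<v) y≮w
... | no  x≮v | yes y<w = contradiction (from y<w) x≮v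
... | no  x≮v | no  y≮w rewrite rank-∷-≮ (map proj₁ Z) x≮v | rank-∷-≮ (map proj₂ Z) y≮w =
  rank-sameOrder Z Z∼

st-orderIsomorphic : ∀ Z → OrderIsomorphic Z → st (map proj₁ Z) ≡ st (map proj₂ Z)
st-orderIsomorphic Z oi = begin
  map (λ c → suc (rank c (map proj₁ Z))) (map proj₁ Z)  ≡⟨ map-∘ Z ⟨
  map (λ p → suc (rank (proj₁ p) (map proj₁ Z))) Z      ≡⟨ map-cong-local (All.tabulate sameRank) ⟩
  map (λ p → suc (rank (proj₂ p) (map proj₂ Z))) Z      ≡⟨ map-∘ Z ⟩
  map (λ c → suc (rank c (map proj₂ Z))) (map proj₂ Z)  ∎
  where
  open ≡-Reasoning
  sameRank : ∀ {p} → p ∈ Z → suc (rank (proj₁ p) (map proj₁ Z)) ≡ suc (rank (proj₂ p) (map proj₂ Z))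
  sameRank p∈ = cong suc (rank-sameOrder Z (All.tabulate (λ q∈ → oi q∈ p∈)))

st≡⇒orderIsomorphic-zip : ∀ xs ys → st xs ≡ st ys → OrderIsomorphic (zip xs ys)
st≡⇒orderIsomorphic-zip xs ys st≡ {x , y} {x′ , y′} p∈ q∈ =
  (λ x<x′ → rank-cancel-< ys (subst₂ _<_ (rank≡ p∈) (rank≡ q∈) (rank-mono-< x∈ x<x′))) ,
  (λ y<y′ → rank-cancel-< xs (subst₂ _<_ (sym (rank≡ p∈)) (sym (rank≡ q∈)) (rank-mono-< y∈ y<y′)))
  where
  x∈ = proj₁ (zip-∈ p∈)
  y∈ = proj₂ (zip-∈ p∈)
  rank≡ : ∀ {p} → p ∈ zip xs ys → rank (proj₁ p) xs ≡ rank (proj₂ p) ys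
  rank≡ = cong pred ∘ All.lookup (AllP.zipWith⁺ _,_ (Pointwise.map⁻ _ _ (Pointwise.≡⇒Pointwise-≡ st≡)))

rankGraph-orderIsomorphic : ∀ xs → OrderIsomorphic (graph (λ c → suc (rank c xs)) xs)
rankGraph-orderIsomorphic xs = graph-orderIsomorphic xs (λ v∈ v<w → s<s (rank-mono-< v∈ v<w))

st-select-st : (select : ∀ {A : Set} → List A → List A) →
  (∀ {A B : Set} (f : A → B) xs → select (map f xs) ≡ map f (select xs)) →
  (∀ {A : Set} (xs : List A) → select xs ⊆ xs) →
  ∀ xs → st (select (st xs)) ≡ st (select xs)
st-select-st select select-map select-⊆ xs = begin
  st (select (st xs))              ≡⟨ cong (st ∘ select) (map-proj₂-graph _ xs) ⟨
  st (select (map proj₂ G))        ≡⟨ cong st (select-map proj₂ G) ⟩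
  st (map proj₂ (select G))        ≡⟨ st-orderIsomorphic (select G) oi ⟨
  st (map proj₁ (select G))        ≡⟨ cong st (select-map proj₁ G) ⟨
  st (select (map proj₁ G))        ≡⟨ cong (st ∘ select) (map-proj₁-graph _ xs) ⟩
  st (select xs)                   ∎
  where
  open ≡-Reasoning
  G = graph (λ c → suc (rank c xs)) xs
  oi = orderIsomorphic-⊆ (select-⊆ G) (rankGraph-orderIsomorphic xs)

st-take-st : ∀ k xs → st (take k (st xs)) ≡ st (take k xs)
st-take-st k = st-select-st (take k) (λ f → take-map k) (take-⊆ k)

st-drop-st : ∀ k xs → st (drop k (st xs)) ≡ st (drop k xs)
st-drop-st k = st-select-st (drop k) (λ f → drop-map k) (drop-⊆ k)

-- Walks along the windows of a sequence

st-take-isPerm : ∀ k {xs} → Unique xs → k ≤ length xs → IsPerm k (st (take k xs))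
st-take-isPerm k {xs} u k≤ =
  subst (λ m → IsPerm m (st (take k xs))) (trans (length-take k xs) (m≤n⇒m⊓n≡m k≤))
        (st-isPerm (take k xs) (UP.take⁺ k u))

windowWalk : ∀ n t {xs} → Unique xs → length xs ≡ n + t → Walk n (st (take n xs)) (st (drop t xs)) t
windowWalk n zero {xs} u len = subst (λ ys → Walk n (st (take n xs)) (st ys) 0) (take-all n xs (≤-reflexive len′))
  (here (st-take-isPerm n u (≤-reflexive (sym len′))))
  where
  len′ : length xs ≡ n
  len′ = trans len (+-identityʳ n)
windowWalk n (suc t) {[]} _ len = contradiction (trans len (+-suc n t)) λ ()
windowWalk n (suc t) {x ∷ xs} u len =
  step (st-take-isPerm n u (≤-trans (n≤1+n n) sn≤)) window (windowWalk n t (AllPairs.tail u) len′)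
  where
  len′ : length xs ≡ n + t
  len′ = suc-injective (trans len (+-suc n t))
  sn≤ : suc n ≤ length (x ∷ xs)
  sn≤ = s≤s (subst (n ≤_) (sym len′) (m≤m+n n t))
  window : Edge n (st (take n (x ∷ xs))) (st (take n xs))
  window = edge (st (take (suc n) (x ∷ xs))) (st-take-isPerm (suc n) u sn≤)
    (trans (st-take-st n (take (suc n) (x ∷ xs)))
           (cong st (trans (take-take n (suc n) (x ∷ xs)) (cong (λ k → take k (x ∷ xs)) (m≤n⇒m⊓n≡m (n≤1+n n))))))
    (st-drop-st 1 (take (suc n) (x ∷ xs)))

-- Gluing two permutations

-- The largest partner of a first component below v, shifted by one so that 0 means none.
supBelow : List (ℕ × ℕ) → ℕ → ℕ
supBelow Z v = max 0 (map (suc ∘ proj₂) (filter ((_<? v) ∘ proj₁) Z))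

supBelow-mono : ∀ Z {v w} → v ≤ w → supBelow Z v ≤ supBelow Z w
supBelow-mono Z {v} {w} v≤w = max-mono-⊆ ≤-refl (⊆-map⁺ (suc ∘ proj₂)
  (⊆-filter⁺′ ((_<? v) ∘ proj₁) ((_<? w) ∘ proj₁) (λ y<v → <-≤-trans y<v v≤w) {Z} ⊆-refl))

supBelow-≥ : ∀ {Z v x y} → (y , x) ∈ Z → y < v → suc x ≤ supBelow Z v
supBelow-≥ {v = v} p∈ y<v =
  All.lookup (xs≤max 0 _) (∈-map⁺ (suc ∘ proj₂) (∈-filter⁺ ((_<? v) ∘ proj₁) p∈ y<v))

supBelow-≤ : ∀ {Z v u} → (∀ {y x} → (y , x) ∈ Z → y < v → x < u) → supBelow Z v ≤ u
supBelow-≤ {v = v} bound = max≤v⁺ z≤n (AllP.map⁺ (All.tabulate λ q∈ →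
  let q∈Z , y<v = ∈-filter⁻ ((_<? v) ∘ proj₁) q∈ in bound q∈Z y<v))

-- Z pairs the entries of b that overlap a with the corresponding entries of a; the remaining
-- entries v < K of b are inserted by lift.
module Gluing (Z : List (ℕ × ℕ)) (K : ℕ) where

  scale : ℕ → ℕ
  scale x = suc K * suc x

  lift : ℕ → ℕ
  lift v = suc K * supBelow Z v + suc v

  scale-mono : scale Preserves _<_ ⟶ _<_
  scale-mono x<y = *-monoʳ-< (suc K) (s<s x<y)

  lift-mono : lift Preserves _<_ ⟶ _<_
  lift-mono v<w = +-mono-≤-< (*-monoʳ-≤ (suc K) (supBelow-mono Z (<⇒≤ v<w))) (s<s v<w)

  scale≢lift : ∀ x {v} → v < K → scale x ≢ lift v
  scale≢lift x {v} v<K with suc x ≤? supBelow Z v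
  ... | yes 1+x≤ = <⇒≢ (m*a<m*b+r (suc K) z<s 1+x≤)
  ... | no  1+x≰ = >⇒≢ (m*b+r<m*a (suc K) (s<s v<K) (≰⇒> 1+x≰))

  scale-lift-sameOrder : OrderIsomorphic Z → ∀ {x y v} → (y , x) ∈ Z → v < K → y ≢ v →
    SameOrder (y , scale x) (v , lift v) × SameOrder (v , lift v) (y , scale x)
  scale-lift-sameOrder oi {x} {y} {v} p∈ v<K y≢v = sameOrder-trichotomy y≢v below above
    where
    below : y < v → scale x < lift v
    below y<v = m*a<m*b+r (suc K) z<s (supBelow-≥ p∈ y<v)
    above : v < y → lift v < scale x
    above v<y = m*b+r<m*a (suc K) (s<s v<K)
      (s≤s (supBelow-≤ λ q∈ y′<v → proj₁ (oi q∈ p∈) (<-trans y′<v v<y)))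

  glue-unique : ∀ {xs N} → Unique xs → Unique N → All (_< K) N → Unique (map scale xs ++ map lift N)
  glue-unique uxs uN N<K = UP.++⁺ (UP.map⁺ (strictMono-injective scale-mono) uxs)
                                  (UP.map⁺ (strictMono-injective lift-mono) uN) apart
    where
    apart : Disjoint (map scale _) (map lift _)
    apart (u∈ , u∈′) with x , _ , refl ← ∈-map⁻ scale u∈ | v , v∈ , eq ← ∈-map⁻ lift u∈′ =
      scale≢lift x (All.lookup N<K v∈) eq

  glue-suffix : OrderIsomorphic Z → ∀ N → Disjoint (map proj₁ Z) N → All (_< K) N →
    st (map (scale ∘ proj₂) Z ++ map lift N) ≡ st (map proj₁ Z ++ N)
  glue-suffix oi N apart N<K = begin
    st (map (scale ∘ proj₂) Z ++ map lift N)  ≡⟨ cong st (cong₂ _++_ (sym (map-∘ Z)) (map-proj₂-graph lift N)) ⟨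
    st (map proj₂ Z₁ ++ map proj₂ Z₂)         ≡⟨ cong st (map-++ proj₂ Z₁ Z₂) ⟨
    st (map proj₂ (Z₁ ++ Z₂))                 ≡⟨ st-orderIsomorphic (Z₁ ++ Z₂) oi₁₂ ⟨
    st (map proj₁ (Z₁ ++ Z₂))                 ≡⟨ cong st (map-++ proj₁ Z₁ Z₂) ⟩
    st (map proj₁ Z₁ ++ map proj₁ Z₂)         ≡⟨ cong st (cong₂ _++_ (sym (map-∘ Z)) (map-proj₁-graph lift N)) ⟩
    st (map proj₁ Z ++ N)                     ∎
    where
    open ≡-Reasoning
    Z₁ = map (Product.map₂ scale) Z
    Z₂ = graph lift N
    cross : ∀ {p q} → p ∈ Z₁ → q ∈ Z₂ → SameOrder p q × SameOrder q p
    cross p∈ q∈ with _ , yx∈ , refl ← ∈-map⁻ _ p∈ | v , v∈ , refl ← ∈-map⁻ _ q∈ =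
      scale-lift-sameOrder oi yx∈ (All.lookup N<K v∈)
        (λ { refl → apart (∈-map⁺ proj₁ yx∈ , v∈) })
    oi₁₂ = ++-orderIsomorphic (map₂-orderIsomorphic scale-mono Z oi)
                              (graph-orderIsomorphic N (λ _ → lift-mono)) cross

glue : ∀ n t {a b} → IsPerm n a → IsPerm n b → t ≤ n → st (drop t a) ≡ st (take (n ∸ t) b) →
  ∃ λ c → Unique c × length c ≡ n + t × st (take n c) ≡ a × st (drop t c) ≡ b
glue n t {a} {b} a↭ b↭ t≤n st-overlap =
  c , glue-unique (isPerm-unique a↭) (UP.drop⁺ m (isPerm-unique b↭)) new<K , |c| , prefix , suffix
  where
  m = n ∸ t
  overlapA = drop t a
  overlapB = take m b
  newB = drop m b
  Z = zip overlapB overlapA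
  open Gluing Z (suc n)
  c = map scale a ++ map lift newB
  open ≡-Reasoning
  new<K : All (_< suc n) newB
  new<K = AllP.drop⁺ m (All.map (s≤s ∘ proj₂) (isPerm-bounds b↭))
  |scaled-a| : length (map scale a) ≡ n
  |scaled-a| = trans (length-map scale a) (isPerm-length a↭)
  |overlap| : length overlapB ≡ length overlapA
  |overlap| = length-take-∸ b a (isPerm-length b↭) (isPerm-length a↭) t≤n
  |c| : length c ≡ n + t
  |c| = trans (length-++ (map scale a)) (cong₂ _+_ |scaled-a|
    (trans (length-map lift newB) (trans (length-drop m b)
      (trans (cong (_∸ m) (isPerm-length b↭)) (m∸[m∸n]≡n t≤n)))))
  prefix : st (take n c) ≡ a
  prefix = begin
    st (take n c)                          ≡⟨ cong (λ k → st (take k c)) |scaled-a| ⟨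
    st (take (length (map scale a)) c)     ≡⟨ cong st (take-length-++ (map scale a) (map lift newB)) ⟩
    st (map scale a)                       ≡⟨ st-map scale-mono a ⟩
    st a                                   ≡⟨ st-fixesPerm a↭ ⟩
    a                                      ∎
  apart : Disjoint (map proj₁ Z) newB
  apart = subst (λ xs → Disjoint xs newB) (sym (map-proj₁-zip |overlap|))
    (unique-++⇒disjoint overlapB (subst Unique (sym (take++drop≡id m b)) (isPerm-unique b↭)))
  suffix : st (drop t c) ≡ b
  suffix = begin
    st (drop t c)                                  ≡⟨ cong st (drop-++-≤ t (map scale a) _ (≤-trans t≤n (≤-reflexive (sym |scaled-a|)))) ⟩
    st (drop t (map scale a) ++ map lift newB)     ≡⟨ cong (λ xs → st (xs ++ map lift newB)) (drop-map t a) ⟩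
    st (map scale overlapA ++ map lift newB)       ≡⟨ cong (λ xs → st (map scale xs ++ map lift newB)) (map-proj₂-zip |overlap|) ⟨
    st (map scale (map proj₂ Z) ++ map lift newB)  ≡⟨ cong (λ xs → st (xs ++ map lift newB)) (map-∘ Z) ⟨
    st (map (scale ∘ proj₂) Z ++ map lift newB)    ≡⟨ glue-suffix (st≡⇒orderIsomorphic-zip overlapB overlapA (sym st-overlap)) newB apart new<K ⟩
    st (map proj₁ Z ++ newB)                       ≡⟨ cong (λ xs → st (xs ++ newB)) (map-proj₁-zip |overlap|) ⟩
    st (overlapB ++ newB)                          ≡⟨ cong st (take++drop≡id m b) ⟩
    st b                                           ≡⟨ st-fixesPerm b↭ ⟩
    b                                              ∎

corollary3p4 : (n t : ℕ) → 2 ≤ n → 1 ≤ t → t ≤ n ∸ 1 →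
    (a b : List ℕ) → Vertex n a → Vertex n b →
    st (drop t a) ≡ st (take (n ∸ t) b) →
    Walk n a b t
corollary3p4 n t _ _ t≤n-1 a b a↭ b↭ st-overlap
  with c , unique-c , |c| , prefix , suffix ← glue n t a↭ b↭ (≤-trans t≤n-1 (m∸n≤m n 1)) st-overlap
  = subst₂ (λ u v → Walk n u v t) prefix suffix (windowWalk n t unique-c |c|)
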